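{- Let $U$ be a perfect cube, $m=U^{1/3}$, $B=U^{2/3}$, and view $[U]$ as $m$ disjoint blocks of size $B$. Fix a deterministic one-way protocol for $\mathsf{UR}^{\subset}_{\mathsf{dec}}$ on universe $[U]$: Alice's message is a function of her set $S$, and Bob's output is a function of $(T,P_1,P_2)$ and Alice's message. Let $\mathcal{S}$ be a nonempty collection of $m$-element sets $S\subseteq[U]$, each containing exactly one element from each block, such that Alice sends the same message on every $S\in\mathcal{S}$, and let $T$ be a set with $T\subsetneq S$ for every $S\in\mathcal{S}$. Consider the random input obtained by choosing $S$ uniformly from $\mathcal{S}$ and then choosing $(P_1,P_2)$ as a uniformly random partition of $[U]\setminus T$ conditioned on $S\setminus T\subseteq P_1$ or $S\setminus T\subseteq P_2$ (equivalently: $S\setminus T$ is placed entirely in $P_1$ or entirely in $P_2$ with probability $1/2$ each, and every element of $[U]\setminus S$ is placed in $P_1$ or $P_2$ uniformly and independently). If, on this random input $(S,T,P_1,P_2)$, the protocol errs with probability at most $1/4$, then \[\sum_{S_1,S_2\in\mathcal{S}}\left(2^{|(S_1\cap S_2)\setminus T|}-1\right)\ge\frac{|\mathcal{S}|^2}{4},\] where the sum is over ordered pairs, and consequently there exists an integer $k\ge1$ such that the number of ordered pairs $(S_1,S_2)\in\mathcal{S}^2$ with $|(S_1\cap S_2)\setminus T|=k$ is at least $\frac{|\mathcal{S}|^2}{4\cdot 2^{2k}}$.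
   Context: The problem $\mathsf{UR}^{\subset}_{\mathsf{dec}}$: Alice receives $S\subseteq[U]$; Bob receives a proper subset $T\subsetneq S$ and a partition $(P_1,P_2)$ of $[U]\setminus T$, with the promise that either $S\setminus T\subseteq P_1$ or $S\setminus T\subseteq P_2$. Alice sends one message to Bob, who must output which part contains $S\setminus T$; the protocol errs if Bob's output is wrong. -}

module Defs where

open import Data.Nat using (ℕ; zero; suc; _+_; _*_; _∸_; _^_; _≤_; _<_; _≤?_; _≟_)
open import Data.Bool using (Bool; true; false; if_then_else_)
open import Data.Fin using (Fin; toℕ)
open import Data.Fin.Subset using (Subset; inside; outside; _⊆_; _∩_; _─_; ∁; ∣_∣)
open import Data.Fin.Subset.Properties using (_⊆?_)
open import Data.Vec using (Vec; []; _∷_; tabulate)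
open import Data.List using (List; []; _∷_; map; _++_; length; filter; concatMap)
open import Data.Nat.ListAction using (sum)
open import Data.Product using (_×_; _,_)
open import Relation.Nullary using (Dec; yes; no; ¬_)
open import Relation.Nullary.Decidable using (⌊_⌋; _×-dec_; _⊎-dec_; ¬?)
open import Data.Sum using (_⊎_)
open import Relation.Binary.PropositionalEquality using (_≡_)
open import Data.Bool.Properties using () renaming (_≟_ to _≟ᵇ_)

allSubsets : (n : ℕ) → List (Subset n)
allSubsets zero = [] ∷ []
allSubsets (suc n) = map (outside ∷_) (allSubsets n) ++ map (inside ∷_) (allSubsets n)

Univ : ℕ → ℕ
Univ m = m * m * m

block : (m : ℕ) → Fin m → Subset (Univ m)
block m j = tabulate (λ i → ⌊ (toℕ j * (m * m) ≤? toℕ i) ×-dec (suc (toℕ i) ≤? suc (toℕ j) * (m * m)) ⌋)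

OnePerBlock : (m : ℕ) → Subset (Univ m) → Set
OnePerBlock m S = (∣ S ∣ ≡ m) × ((j : Fin m) → ∣ S ∩ block m j ∣ ≡ 1)

-- (P₁ , P₂) with P₁ ⊆ [U]∖T and P₂ = ([U]∖T) ∖ P₁ ranges over all partitions of [U]∖T.
-- Promise: S∖T ⊆ P₁ or S∖T ⊆ P₂.
Valid : {n : ℕ} → (S T P₁ : Subset n) → Set
Valid S T P₁ = (P₁ ⊆ ∁ T) × ((S ─ T ⊆ P₁) ⊎ (S ─ T ⊆ (∁ T ─ P₁)))

valid? : {n : ℕ} → (S T P₁ : Subset n) → Dec (Valid S T P₁)
valid? S T P₁ = (P₁ ⊆? ∁ T) ×-dec ((S ─ T ⊆? P₁) ⊎-dec (S ─ T ⊆? (∁ T ─ P₁)))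

-- Bob's output: true means "P₁", false means "P₂".
-- The protocol errs if the output differs from whether S∖T ⊆ P₁.
Errs : {n : ℕ} {M : Set} → (bob : Subset n → Subset n → Subset n → M → Bool) →
       M → (S T P₁ : Subset n) → Set
Errs bob msg S T P₁ = Valid S T P₁ × ¬ (bob T P₁ (∁ T ─ P₁) msg ≡ ⌊ S ─ T ⊆? P₁ ⌋)

errs? : {n : ℕ} {M : Set} → (bob : Subset n → Subset n → Subset n → M → Bool) →
        (msg : M) → (S T P₁ : Subset n) → Dec (Errs bob msg S T P₁)
errs? bob msg S T P₁ = valid? S T P₁ ×-dec ¬? (bob T P₁ (∁ T ─ P₁) msg ≟ᵇ ⌊ S ─ T ⊆? P₁ ⌋)

validCount : {n : ℕ} → (S T : Subset n) → ℕ
validCount {n} S T = length (filter (valid? S T) (allSubsets n))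

errCount : {n : ℕ} {M : Set} → (alice : Subset n → M) →
           (bob : Subset n → Subset n → Subset n → M → Bool) → (S T : Subset n) → ℕ
errCount {n} alice bob S T = length (filter (errs? bob (alice S) S T) (allSubsets n))

sumPairs : {A : Set} → List A → (A → A → ℕ) → ℕ
sumPairs xs f = sum (concatMap (λ x → map (f x) xs) xs)

pairsWith : {n : ℕ} → List (Subset n) → Subset n → ℕ → ℕ
pairsWith 𝒮 T k = sumPairs 𝒮 (λ S₁ S₂ → if ⌊ ∣ (S₁ ∩ S₂) ─ T ∣ ≟ k ⌋ then 1 else 0)

module Submission where

-- Proof idea (a Fourier / Cauchy–Schwarz argument over the random partition).
-- Fix the common message of 𝒮.  For S ∈ 𝒮 let χ_S(P) be +1 if S∖T ⊆ P₁, −1 if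
-- S∖T ⊆ P₂ and 0 if (S,T,P) is not a valid input, where P₁ = P ⊆ [U]∖T and
-- P₂ = ([U]∖T)∖P; let β(P) = ±1 be Bob's answer on the partition P.  Then
--   Σ_P β χ_S = #valid(S) − 2·#err(S),      Σ_P β² = #{P ⊆ [U]∖T},
--   Σ_P χ_A χ_B = 2^(U−|T|−2d+1)·(2^k − [k = 0])   with k = |(A∩B)∖T|, d = |S∖T|.
-- The last identity is the heart of the proof; every such count is a sum over
-- all subsets P of a product of per-coordinate weights, which factorises into
-- a product over coordinates and is then evaluated by a finite truth table.
-- With F = Σ_S χ_S, the error bound gives Σ_P βF ≥ ½ Σ_S #valid(S), and the
-- inequality 2DsβF ≤ D²F² + s²β² (Cauchy–Schwarz without square roots) turns
-- this into |𝒮|² ≤ Σ_{S₁,S₂} 2(2^k − [k = 0]) ≤ 4 Σ_{S₁,S₂} (2^k − 1).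
-- Finally, if every k ≥ 1 had fewer than |𝒮|²/(4·4^k) pairs, the right-hand
-- side would be smaller than |𝒮|², since Σ_{k≥1} (2^k − 1)/4^k < 1.
-- The file develops: integer sums over lists; factorisation of sums of
-- coordinate products; the correlation identity for χ; the protocol
-- identities; the abstract averaging inequality; the choice of k; lemma4.

open import Defs
open import Data.Nat using (ℕ; _+_; _*_; _∸_; _^_; _≤_; _≥_)
open import Data.Bool using (Bool)
open import Data.Fin.Subset using (Subset; _⊂_; _∩_; _─_; ∣_∣)
open import Data.List using (List; []; _∷_; length; map)
open import Data.Nat.ListAction using (sum)
open import Data.List.Relation.Unary.All using (All)
open import Data.List.Relation.Unary.Unique.Propositional using (Unique)
open import Data.List.Membership.Propositional using (_∈_)
open import Data.Product using (_×_; ∃-syntax)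
open import Relation.Binary.PropositionalEquality using (_≡_; _≢_)

open import Data.Nat using (zero; suc; _<_; z≤n; s≤s; _≤?_) renaming (_≟_ to _≟ℕ_)
import Data.Nat.Properties as ℕP
open import Data.Nat.Tactic.RingSolver using () renaming (solve-∀ to solve-∀ℕ)
open import Data.Nat.ListAction.Properties using (sum-++)
open import Data.List using (_++_; filter; concatMap)
open import Data.List.Relation.Unary.All using () renaming (lookup to All-lookup)
open import Data.List.Relation.Unary.Any using (here; there)
open import Data.Integer.Base using (ℤ; +_; +0; -[1+_]; +≤+; +<+; NonNegative; Positive; nonNegative; positive)
  renaming (_+_ to _+ᶻ_; _*_ to _*ᶻ_; -_ to negᶻ; _-_ to _-ᶻ_; _≤_ to _≤ᶻ_)
import Data.Integer.Properties as ℤP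
open import Data.Integer.Tactic.RingSolver using (solve-∀)
open import Data.Bool using (true; false; not; _∧_; _∨_; if_then_else_)
open import Data.Bool.Properties using () renaming (_≟_ to _≟ᵇ_)
open import Data.Vec using ([]; _∷_; here; there)
open import Data.Fin.Subset using (_⊆_; ∁) renaming (_∈_ to _∈ˢ_)
open import Data.Fin.Subset.Properties using (_⊆?_; x∈p∧x∉q⇒x∈p─q; drop-∷-⊆; ∣p∣≤n; ∩-idem)
open import Data.Product using (_,_; ∃; proj₁)
open import Data.Sum using (_⊎_; inj₁; inj₂)
open import Data.Empty using (⊥; ⊥-elim)
open import Relation.Binary.PropositionalEquality
  using (refl; sym; trans; cong; cong₂; subst; subst₂; module ≡-Reasoning)
open import Relation.Nullary using (Dec; yes; no; does)
open import Relation.Nullary.Decidable using (⌊_⌋; dec-true; dec-false; isYes≗does)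

ι : Bool → ℤ
ι true = + 1
ι false = +0

ι-∧ : ∀ x y → ι (x ∧ y) ≡ ι x *ᶻ ι y
ι-∧ true y = sym (ℤP.*-identityˡ _)
ι-∧ false y = refl

sgn : Bool → ℤ
sgn true = + 1
sgn false = -[1+ 0 ]

∑ : {A : Set} → List A → (A → ℤ) → ℤ
∑ [] f = +0
∑ (x ∷ xs) f = f x +ᶻ ∑ xs f

module _ {A : Set} where

  ∑-congᵐ : (xs : List A) {f g : A → ℤ} → (∀ {x} → x ∈ xs → f x ≡ g x) → ∑ xs f ≡ ∑ xs g
  ∑-congᵐ [] eq = refl
  ∑-congᵐ (x ∷ xs) eq = cong₂ _+ᶻ_ (eq (here refl)) (∑-congᵐ xs (λ x∈xs → eq (there x∈xs)))

  ∑-cong : (xs : List A) {f g : A → ℤ} → (∀ x → f x ≡ g x) → ∑ xs f ≡ ∑ xs g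
  ∑-cong xs eq = ∑-congᵐ xs (λ {x} _ → eq x)

  ∑-+ : (xs : List A) (f g : A → ℤ) → ∑ xs (λ x → f x +ᶻ g x) ≡ ∑ xs f +ᶻ ∑ xs g
  ∑-+ [] f g = refl
  ∑-+ (x ∷ xs) f g = trans (cong (f x +ᶻ g x +ᶻ_) (∑-+ xs f g)) (interchange (f x) (g x) (∑ xs f) (∑ xs g))
    where interchange : ∀ a b c d → (a +ᶻ b) +ᶻ (c +ᶻ d) ≡ (a +ᶻ c) +ᶻ (b +ᶻ d)
          interchange = solve-∀

  ∑-- : (xs : List A) (f g : A → ℤ) → ∑ xs (λ x → f x -ᶻ g x) ≡ ∑ xs f -ᶻ ∑ xs g
  ∑-- [] f g = refl
  ∑-- (x ∷ xs) f g = trans (cong (f x -ᶻ g x +ᶻ_) (∑-- xs f g)) (interchange (f x) (g x) (∑ xs f) (∑ xs g))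
    where interchange : ∀ a b c d → (a -ᶻ b) +ᶻ (c -ᶻ d) ≡ (a +ᶻ c) -ᶻ (b +ᶻ d)
          interchange = solve-∀

  ∑-* : (xs : List A) (c : ℤ) (f : A → ℤ) → ∑ xs (λ x → c *ᶻ f x) ≡ c *ᶻ ∑ xs f
  ∑-* [] c f = sym (ℤP.*-zeroʳ c)
  ∑-* (x ∷ xs) c f = trans (cong (c *ᶻ f x +ᶻ_) (∑-* xs c f)) (sym (ℤP.*-distribˡ-+ c (f x) (∑ xs f)))

  ∑-++ : (xs ys : List A) (f : A → ℤ) → ∑ (xs ++ ys) f ≡ ∑ xs f +ᶻ ∑ ys f
  ∑-++ [] ys f = sym (ℤP.+-identityˡ _)
  ∑-++ (x ∷ xs) ys f = trans (cong (f x +ᶻ_) (∑-++ xs ys f)) (sym (ℤP.+-assoc (f x) _ _))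

  ∑-map : {B : Set} (h : B → A) (xs : List B) (f : A → ℤ) → ∑ (map h xs) f ≡ ∑ xs (λ x → f (h x))
  ∑-map h [] f = refl
  ∑-map h (x ∷ xs) f = cong (f (h x) +ᶻ_) (∑-map h xs f)

  ∑-mono : (xs : List A) {f g : A → ℤ} → (∀ x → f x ≤ᶻ g x) → ∑ xs f ≤ᶻ ∑ xs g
  ∑-mono [] le = ℤP.≤-refl
  ∑-mono (x ∷ xs) le = ℤP.+-mono-≤ (le x) (∑-mono xs le)

  ∑-const : (xs : List A) (c : ℤ) → ∑ xs (λ _ → c) ≡ + length xs *ᶻ c
  ∑-const [] c = refl
  ∑-const (x ∷ xs) c = trans (cong (c +ᶻ_) (∑-const xs c)) (factor c (+ length xs))
    where factor : ∀ c l → c +ᶻ l *ᶻ c ≡ (+ 1 +ᶻ l) *ᶻ c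
          factor = solve-∀

  ∑-sum : (xs : List A) (f : A → ℕ) → ∑ xs (λ x → + f x) ≡ + sum (map f xs)
  ∑-sum [] f = refl
  ∑-sum (x ∷ xs) f = trans (cong (+ f x +ᶻ_) (∑-sum xs f)) (sym (ℤP.pos-+ (f x) _))

  ∑-count : {P : A → Set} (P? : (x : A) → Dec (P x)) (xs : List A) →
            ∑ xs (λ x → ι (does (P? x))) ≡ + length (filter P? xs)
  ∑-count P? [] = refl
  ∑-count P? (x ∷ xs) with does (P? x)
  ... | true = cong (+ 1 +ᶻ_) (∑-count P? xs)
  ... | false = trans (ℤP.+-identityˡ _) (∑-count P? xs)

∑-swap : {A B : Set} (xs : List A) (ys : List B) (f : A → B → ℤ) →
         ∑ xs (λ x → ∑ ys (f x)) ≡ ∑ ys (λ y → ∑ xs (λ x → f x y))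
∑-swap [] ys f = sym (trans (∑-const ys +0) (ℤP.*-zeroʳ (+ length ys)))
∑-swap (x ∷ xs) ys f =
  trans (cong (∑ ys (f x) +ᶻ_) (∑-swap xs ys f)) (sym (∑-+ ys (f x) (λ y → ∑ xs (λ x → f x y))))

∑-mul : {A B : Set} (xs : List A) (ys : List B) (f : A → ℤ) (g : B → ℤ) →
        ∑ xs f *ᶻ ∑ ys g ≡ ∑ xs (λ x → ∑ ys (λ y → f x *ᶻ g y))
∑-mul [] ys f g = refl
∑-mul (x ∷ xs) ys f g = trans (ℤP.*-distribʳ-+ (∑ ys g) (f x) (∑ xs f))
  (cong₂ _+ᶻ_ (sym (∑-* ys (f x) g)) (∑-mul xs ys f g))

∑-pairs : {A B : Set} (xs : List A) (ys : List B) (f : A → B → ℕ) →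
          + sum (concatMap (λ x → map (f x) ys) xs) ≡ ∑ xs (λ x → ∑ ys (λ y → + f x y))
∑-pairs [] ys f = refl
∑-pairs (x ∷ xs) ys f = trans (cong +_ (sum-++ (map (f x) ys) _))
  (trans (ℤP.pos-+ (sum (map (f x) ys)) _) (cong₂ _+ᶻ_ (sym (∑-sum ys (f x))) (∑-pairs xs ys f)))

-- [j, j−1, …, 1]: the possible sizes of a nonempty subset of a j-element set.
positives : ℕ → List ℕ
positives zero = []
positives (suc j) = suc j ∷ positives j

∑-indicator-above : ∀ j k → j < k → (c : ℕ → ℤ) →
                    ∑ (positives j) (λ i → c i *ᶻ ι (does (k ≟ℕ i))) ≡ +0
∑-indicator-above zero k j<k c = refl
∑-indicator-above (suc j) k j<k c = cong₂ _+ᶻ_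
  (trans (cong (λ b → c (suc j) *ᶻ ι b) (dec-false (k ≟ℕ suc j) (λ k≡ → ℕP.<-irrefl (sym k≡) j<k)))
         (ℤP.*-zeroʳ (c (suc j))))
  (∑-indicator-above j k (ℕP.<-trans (ℕP.n<1+n j) j<k) c)

∑-indicator : ∀ j k → k ≤ j → (c : ℕ → ℤ) → c 0 ≡ +0 →
              ∑ (positives j) (λ i → c i *ᶻ ι (does (k ≟ℕ i))) ≡ c k
∑-indicator zero zero z≤n c c0≡0 = sym c0≡0
∑-indicator (suc j) k k≤j c c0≡0 with k ≟ℕ suc j
... | yes refl = trans (cong₂ _+ᶻ_
        (trans (cong (λ b → c (suc j) *ᶻ ι b) (dec-true (suc j ≟ℕ suc j) refl)) (ℤP.*-identityʳ (c (suc j))))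
        (∑-indicator-above j (suc j) (ℕP.n<1+n j) c))
      (ℤP.+-identityʳ _)
... | no k≢ = trans (cong₂ _+ᶻ_
        (trans (cong (λ b → c (suc j) *ᶻ ι b) (dec-false (k ≟ℕ suc j) k≢)) (ℤP.*-zeroʳ (c (suc j))))
        (∑-indicator j k (ℕP.≤-pred (ℕP.≤∧≢⇒< k≤j k≢)) c c0≡0))
      (ℤP.+-identityˡ _)

∏₃ : ∀ {n} → (Bool → Bool → Bool → ℤ) → Subset n → Subset n → Subset n → ℤ
∏₃ w [] [] [] = + 1
∏₃ w (a ∷ A) (b ∷ B) (t ∷ T) = w a b t *ᶻ ∏₃ w A B T

∏₄ : ∀ {n} → (Bool → Bool → Bool → Bool → ℤ) → Subset n → Subset n → Subset n → Subset n → ℤ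
∏₄ w [] [] [] [] = + 1
∏₄ w (a ∷ A) (b ∷ B) (t ∷ T) (p ∷ P) = w a b t p *ᶻ ∏₄ w A B T P

-- Summing a coordinate product over all subsets P factorises: each coordinate
-- of P is chosen independently.
∑-∏₄ : ∀ {n} (w : Bool → Bool → Bool → Bool → ℤ) (A B T : Subset n) →
       ∑ (allSubsets n) (∏₄ w A B T) ≡ ∏₃ (λ a b t → w a b t false +ᶻ w a b t true) A B T
∑-∏₄ w [] [] [] = refl
∑-∏₄ {suc n} w (a ∷ A) (b ∷ B) (t ∷ T) = begin
  ∑ (map (false ∷_) Ps ++ map (true ∷_) Ps) (∏₄ w (a ∷ A) (b ∷ B) (t ∷ T))
    ≡⟨ ∑-++ (map (false ∷_) Ps) _ _ ⟩
  ∑ (map (false ∷_) Ps) (∏₄ w (a ∷ A) (b ∷ B) (t ∷ T)) +ᶻ ∑ (map (true ∷_) Ps) (∏₄ w (a ∷ A) (b ∷ B) (t ∷ T))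
    ≡⟨ cong₂ _+ᶻ_ (∑-map (false ∷_) Ps _) (∑-map (true ∷_) Ps _) ⟩
  ∑ Ps (λ P → w₀ *ᶻ ∏₄ w A B T P) +ᶻ ∑ Ps (λ P → w₁ *ᶻ ∏₄ w A B T P)
    ≡⟨ cong₂ _+ᶻ_ (∑-* Ps w₀ (∏₄ w A B T)) (∑-* Ps w₁ (∏₄ w A B T)) ⟩
  w₀ *ᶻ ∑ Ps (∏₄ w A B T) +ᶻ w₁ *ᶻ ∑ Ps (∏₄ w A B T)
    ≡⟨ sym (ℤP.*-distribʳ-+ _ w₀ w₁) ⟩
  (w₀ +ᶻ w₁) *ᶻ ∑ Ps (∏₄ w A B T)
    ≡⟨ cong ((w₀ +ᶻ w₁) *ᶻ_) (∑-∏₄ w A B T) ⟩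
  (w₀ +ᶻ w₁) *ᶻ ∏₃ (λ a b t → w a b t false +ᶻ w a b t true) A B T ∎
  where
  open ≡-Reasoning
  Ps = allSubsets n
  w₀ = w a b t false
  w₁ = w a b t true

∏₃-* : ∀ {n} (v w : Bool → Bool → Bool → ℤ) (A B T : Subset n) →
       ∏₃ v A B T *ᶻ ∏₃ w A B T ≡ ∏₃ (λ a b t → v a b t *ᶻ w a b t) A B T
∏₃-* v w [] [] [] = refl
∏₃-* v w (a ∷ A) (b ∷ B) (t ∷ T) =
  trans (interchange (v a b t) (w a b t) (∏₃ v A B T) (∏₃ w A B T))
        (cong (v a b t *ᶻ w a b t *ᶻ_) (∏₃-* v w A B T))
  where interchange : ∀ x y z u → (x *ᶻ z) *ᶻ (y *ᶻ u) ≡ (x *ᶻ y) *ᶻ (z *ᶻ u)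
        interchange = solve-∀

∏₃-cong : ∀ {n} {v w : Bool → Bool → Bool → ℤ} → (∀ a b t → v a b t ≡ w a b t) →
          (A B T : Subset n) → ∏₃ v A B T ≡ ∏₃ w A B T
∏₃-cong eq [] [] [] = refl
∏₃-cong eq (a ∷ A) (b ∷ B) (t ∷ T) = cong₂ _*ᶻ_ (eq a b t) (∏₃-cong eq A B T)

∏₃-double : ∀ {n} (w : Bool → Bool → Bool → ℤ) (A B T : Subset n) →
            ∏₃ (λ a b t → + 2 *ᶻ w a b t) A B T ≡ + (2 ^ n) *ᶻ ∏₃ w A B T
∏₃-double w [] [] [] = refl
∏₃-double {suc n} w (a ∷ A) (b ∷ B) (t ∷ T) =
  trans (cong (+ 2 *ᶻ w a b t *ᶻ_) (∏₃-double w A B T))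
    (trans (regroup (w a b t) (+ (2 ^ n)) (∏₃ w A B T))
           (cong (_*ᶻ (w a b t *ᶻ ∏₃ w A B T)) (sym (ℤP.pos-* 2 (2 ^ n)))))
  where regroup : ∀ x y z → (+ 2 *ᶻ x) *ᶻ (y *ᶻ z) ≡ (+ 2 *ᶻ y) *ᶻ (x *ᶻ z)
        regroup = solve-∀

minus : Bool → Bool → Bool
minus x true = false
minus x false = x

─-∷ : ∀ {n} x (X : Subset n) y Y → (x ∷ X) ─ (y ∷ Y) ≡ minus x y ∷ (X ─ Y)
─-∷ x X true Y = refl
─-∷ x X false Y = refl

⊆?-∷ : ∀ {n} x y (X Y : Subset n) → does ((x ∷ X) ⊆? (y ∷ Y)) ≡ (not x ∨ y) ∧ does (X ⊆? Y)
⊆?-∷ true true X Y = refl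
⊆?-∷ true false X Y = refl
⊆?-∷ false y X Y = refl

two^ : Bool → ℤ
two^ true = + 2
two^ false = + 1

pow2 : ∀ {n} → Subset n → ℤ
pow2 [] = + 1
pow2 (x ∷ X) = two^ x *ᶻ pow2 X

pow2≡ : ∀ {n} (X : Subset n) → pow2 X ≡ + (2 ^ ∣ X ∣)
pow2≡ [] = refl
pow2≡ (true ∷ X) = trans (cong (+ 2 *ᶻ_) (pow2≡ X)) (sym (ℤP.pos-* 2 (2 ^ ∣ X ∣)))
pow2≡ (false ∷ X) = trans (ℤP.*-identityˡ _) (pow2≡ X)

isEmpty : ∀ {n} → Subset n → Bool
isEmpty [] = true
isEmpty (x ∷ X) = not x ∧ isEmpty X

isEmpty≡ : ∀ {n} (X : Subset n) → isEmpty X ≡ does (∣ X ∣ ≟ℕ 0)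
isEmpty≡ [] = refl
isEmpty≡ (true ∷ X) = refl
isEmpty≡ (false ∷ X) = isEmpty≡ X

∣─∣+∣∣ : ∀ {n} (S T : Subset n) → T ⊆ S → ∣ S ─ T ∣ + ∣ T ∣ ≡ ∣ S ∣
∣─∣+∣∣ [] [] T⊆S = refl
∣─∣+∣∣ (true ∷ S) (false ∷ T) T⊆S = cong suc (∣─∣+∣∣ S T (drop-∷-⊆ T⊆S))
∣─∣+∣∣ (false ∷ S) (false ∷ T) T⊆S = ∣─∣+∣∣ S T (drop-∷-⊆ T⊆S)
∣─∣+∣∣ (true ∷ S) (true ∷ T) T⊆S = trans (ℕP.+-suc ∣ S ─ T ∣ ∣ T ∣) (cong suc (∣─∣+∣∣ S T (drop-∷-⊆ T⊆S)))
∣─∣+∣∣ (false ∷ S) (true ∷ T) T⊆S with T⊆S here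
... | ()

⊂⇒∣─∣≢0 : ∀ {n} (S T : Subset n) → T ⊂ S → ∣ S ─ T ∣ ≢ 0
⊂⇒∣─∣≢0 S T (_ , x , x∈S , x∉T) = nonempty (S ─ T) (x∈p∧x∉q⇒x∈p─q x∈S x∉T)
  where
  nonempty : ∀ {n} {x} (X : Subset n) → x ∈ˢ X → ∣ X ∣ ≢ 0
  nonempty (true ∷ X) _ ()
  nonempty (false ∷ X) (there x∈X) = nonempty X x∈X

⊆-both⇒empty : ∀ {n} (X Y Z : Subset n) → does (X ⊆? Y) ≡ true → does (X ⊆? (Z ─ Y)) ≡ true → ∣ X ∣ ≡ 0
⊆-both⇒empty [] [] [] _ _ = refl
⊆-both⇒empty (false ∷ X) (y ∷ Y) (z ∷ Z) X⊆Y X⊆Z─Y =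
  ⊆-both⇒empty X Y Z X⊆Y (trans (cong (λ W → does ((false ∷ X) ⊆? W)) (sym (─-∷ z Z y Y))) X⊆Z─Y)
⊆-both⇒empty (true ∷ X) (false ∷ Y) (z ∷ Z) () _
⊆-both⇒empty (true ∷ X) (true ∷ Y) (z ∷ Z) _ ()

-- Whether P ⊆ [U]∖T, i.e. whether (P , ([U]∖T)∖P) is a partition of [U]∖T.
isPartition : ∀ {n} → Subset n → Subset n → Bool
isPartition T P = does (P ⊆? ∁ T)

part : ∀ {n} → Bool → Subset n → Subset n → Subset n
part true T P = P
part false T P = ∁ T ─ P

inPart : ∀ {n} → Bool → Subset n → Subset n → Subset n → Bool
inPart σ S T P = does ((S ─ T) ⊆? part σ T P)

-- χ S T P is +1 if S∖T ⊆ P₁, −1 if S∖T ⊆ P₂ and 0 if P is not a partition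
-- of [U]∖T (when S∖T ≠ ∅ the first two cases exclude each other).
χ : ∀ {n} → Subset n → Subset n → Subset n → ℤ
χ S T P = ι (isPartition T P ∧ inPart true S T P) -ᶻ ι (isPartition T P ∧ inPart false S T P)

partBit : Bool → Bool → Bool → Bool
partBit true t p = p
partBit false t p = minus (not t) p

part-∷ : ∀ {n} σ t (T : Subset n) p P → part σ (t ∷ T) (p ∷ P) ≡ partBit σ t p ∷ part σ T P
part-∷ true t T p P = refl
part-∷ false t T p P = ─-∷ (not t) (∁ T) p P

ι-isPartition-∷ : ∀ {n} t (T : Subset n) p P →
                  ι (isPartition (t ∷ T) (p ∷ P)) ≡ ι (not p ∨ not t) *ᶻ ι (isPartition T P)
ι-isPartition-∷ t T p P = trans (cong ι (⊆?-∷ p (not t) P (∁ T))) (ι-∧ (not p ∨ not t) (isPartition T P))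

ι-inPart-∷ : ∀ {n} σ a (A : Subset n) t T p P →
             ι (inPart σ (a ∷ A) (t ∷ T) (p ∷ P)) ≡ ι (not (minus a t) ∨ partBit σ t p) *ᶻ ι (inPart σ A T P)
ι-inPart-∷ σ a A t T p P = trans
  (cong ι (trans (cong₂ (λ X Y → does (X ⊆? Y)) (─-∷ a A t T) (part-∷ σ t T p P))
                 (⊆?-∷ (minus a t) (partBit σ t p) (A ─ T) (part σ T P))))
  (ι-∧ (not (minus a t) ∨ partBit σ t p) (inPart σ A T P))

both : ∀ {n} → Bool → Bool → Subset n → Subset n → Subset n → Subset n → ℤ
both σ₁ σ₂ A B T P = ι (isPartition T P) *ᶻ ι (inPart σ₁ A T P) *ᶻ ι (inPart σ₂ B T P)

bothWeight : Bool → Bool → Bool → Bool → Bool → Bool → ℤ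
bothWeight σ₁ σ₂ a b t p =
  ι (not p ∨ not t) *ᶻ ι (not (minus a t) ∨ partBit σ₁ t p) *ᶻ ι (not (minus b t) ∨ partBit σ₂ t p)

both≡∏₄ : ∀ {n} σ₁ σ₂ (A B T P : Subset n) → both σ₁ σ₂ A B T P ≡ ∏₄ (bothWeight σ₁ σ₂) A B T P
both≡∏₄ true true [] [] [] [] = refl
both≡∏₄ true false [] [] [] [] = refl
both≡∏₄ false true [] [] [] [] = refl
both≡∏₄ false false [] [] [] [] = refl
both≡∏₄ σ₁ σ₂ (a ∷ A) (b ∷ B) (t ∷ T) (p ∷ P) =
  trans (cong₂ _*ᶻ_ (cong₂ _*ᶻ_ (ι-isPartition-∷ t T p P) (ι-inPart-∷ σ₁ a A t T p P)) (ι-inPart-∷ σ₂ b B t T p P))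
  (trans (regroup (ι (not p ∨ not t)) (ι (not (minus a t) ∨ partBit σ₁ t p)) (ι (not (minus b t) ∨ partBit σ₂ t p))
                  (ι (isPartition T P)) (ι (inPart σ₁ A T P)) (ι (inPart σ₂ B T P)))
         (cong (bothWeight σ₁ σ₂ a b t p *ᶻ_) (both≡∏₄ σ₁ σ₂ A B T P)))
  where regroup : ∀ x y z u v w → (x *ᶻ u) *ᶻ (y *ᶻ v) *ᶻ (z *ᶻ w) ≡ (x *ᶻ y *ᶻ z) *ᶻ (u *ᶻ v *ᶻ w)
        regroup = solve-∀

χ*χ : ∀ {n} (A B T P : Subset n) → χ A T P *ᶻ χ B T P ≡
      both true true A B T P -ᶻ both true false A B T P -ᶻ both false true A B T P +ᶻ both false false A B T P
χ*χ A B T P = expand (isPartition T P) (inPart true A T P) (inPart false A T P) (inPart true B T P) (inPart false B T P)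
  where
  expand : ∀ c u w u′ w′ → (ι (c ∧ u) -ᶻ ι (c ∧ w)) *ᶻ (ι (c ∧ u′) -ᶻ ι (c ∧ w′)) ≡
           ι c *ᶻ ι u *ᶻ ι u′ -ᶻ ι c *ᶻ ι u *ᶻ ι w′ -ᶻ ι c *ᶻ ι w *ᶻ ι u′ +ᶻ ι c *ᶻ ι w *ᶻ ι w′
  expand true u w u′ w′ = ring (ι u) (ι w) (ι u′) (ι w′)
    where ring : ∀ a b c d → (a -ᶻ b) *ᶻ (c -ᶻ d) ≡
                 + 1 *ᶻ a *ᶻ c -ᶻ + 1 *ᶻ a *ᶻ d -ᶻ + 1 *ᶻ b *ᶻ c +ᶻ + 1 *ᶻ b *ᶻ d
          ring = solve-∀
  expand false u w u′ w′ = refl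

scale : Bool → Bool → Bool → ℤ
scale a b t = two^ (minus a t) *ᶻ two^ (minus b t) *ᶻ two^ t

∏-scale : ∀ {n} (A B T : Subset n) → ∏₃ scale A B T ≡ pow2 (A ─ T) *ᶻ pow2 (B ─ T) *ᶻ pow2 T
∏-scale [] [] [] = refl
∏-scale (a ∷ A) (b ∷ B) (t ∷ T) =
  trans (cong (scale a b t *ᶻ_) (∏-scale A B T))
  (trans (regroup (two^ (minus a t)) (two^ (minus b t)) (two^ t) (pow2 (A ─ T)) (pow2 (B ─ T)) (pow2 T))
         (sym (cong₂ (λ X Y → pow2 X *ᶻ pow2 Y *ᶻ (two^ t *ᶻ pow2 T)) (─-∷ a A t T) (─-∷ b B t T))))
  where regroup : ∀ x y z u v w → (x *ᶻ y *ᶻ z) *ᶻ (u *ᶻ v *ᶻ w) ≡ (x *ᶻ u) *ᶻ (y *ᶻ v) *ᶻ (z *ᶻ w)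
        regroup = solve-∀

-- Weights whose products are 2^|K| and [K = ∅] for K = (A ∩ B)∖T; the first
-- arises when both sets must lie in the same part, the second for opposite parts.
sameWeight oppositeWeight : Bool → Bool → Bool → ℤ
sameWeight a b t = two^ (minus (a ∧ b) t)
oppositeWeight a b t = ι (not (minus (a ∧ b) t))

∏-same : ∀ {n} (A B T : Subset n) → ∏₃ sameWeight A B T ≡ pow2 ((A ∩ B) ─ T)
∏-same [] [] [] = refl
∏-same (a ∷ A) (b ∷ B) (t ∷ T) =
  trans (cong (sameWeight a b t *ᶻ_) (∏-same A B T)) (cong pow2 (sym (─-∷ (a ∧ b) (A ∩ B) t T)))

∏-opposite : ∀ {n} (A B T : Subset n) → ∏₃ oppositeWeight A B T ≡ ι (isEmpty ((A ∩ B) ─ T))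
∏-opposite [] [] [] = refl
∏-opposite (a ∷ A) (b ∷ B) (t ∷ T) =
  trans (cong (oppositeWeight a b t *ᶻ_) (∏-opposite A B T))
  (trans (sym (ι-∧ (not (minus (a ∧ b) t)) (isEmpty ((A ∩ B) ─ T))))
         (cong (λ X → ι (isEmpty X)) (sym (─-∷ (a ∧ b) (A ∩ B) t T))))

sideWeight : Bool → Bool → Bool → Bool → Bool → ℤ
sideWeight true true = sameWeight
sideWeight false false = sameWeight
sideWeight true false = oppositeWeight
sideWeight false true = oppositeWeight

-- The single-coordinate computation behind the correlation identity: summing
-- out the bit of P and scaling leaves twice the same/opposite-part weight.
coordinate-table : ∀ σ₁ σ₂ a b t →
  scale a b t *ᶻ (bothWeight σ₁ σ₂ a b t false +ᶻ bothWeight σ₁ σ₂ a b t true) ≡ + 2 *ᶻ sideWeight σ₁ σ₂ a b t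
coordinate-table true true a b true = refl
coordinate-table true false a b true = refl
coordinate-table false true a b true = refl
coordinate-table false false a b true = refl
coordinate-table true true true true false = refl
coordinate-table true true true false false = refl
coordinate-table true true false true false = refl
coordinate-table true true false false false = refl
coordinate-table true false true true false = refl
coordinate-table true false true false false = refl
coordinate-table true false false true false = refl
coordinate-table true false false false false = refl
coordinate-table false true true true false = refl
coordinate-table false true true false false = refl
coordinate-table false true false true false = refl
coordinate-table false true false false false = refl
coordinate-table false false true true false = refl
coordinate-table false false true false false = refl
coordinate-table false false false true false = refl
coordinate-table false false false false false = refl

∑-both : ∀ {n} σ₁ σ₂ (A B T : Subset n) →
         ∏₃ scale A B T *ᶻ ∑ (allSubsets n) (both σ₁ σ₂ A B T) ≡ + (2 ^ n) *ᶻ ∏₃ (sideWeight σ₁ σ₂) A B T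
∑-both {n} σ₁ σ₂ A B T = begin
  ∏₃ scale A B T *ᶻ ∑ (allSubsets n) (both σ₁ σ₂ A B T)
    ≡⟨ cong (∏₃ scale A B T *ᶻ_) (trans (∑-cong (allSubsets n) (both≡∏₄ σ₁ σ₂ A B T)) (∑-∏₄ (bothWeight σ₁ σ₂) A B T)) ⟩
  ∏₃ scale A B T *ᶻ ∏₃ (λ a b t → bothWeight σ₁ σ₂ a b t false +ᶻ bothWeight σ₁ σ₂ a b t true) A B T
    ≡⟨ ∏₃-* scale _ A B T ⟩
  ∏₃ (λ a b t → scale a b t *ᶻ (bothWeight σ₁ σ₂ a b t false +ᶻ bothWeight σ₁ σ₂ a b t true)) A B T
    ≡⟨ ∏₃-cong (coordinate-table σ₁ σ₂) A B T ⟩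
  ∏₃ (λ a b t → + 2 *ᶻ sideWeight σ₁ σ₂ a b t) A B T
    ≡⟨ ∏₃-double (sideWeight σ₁ σ₂) A B T ⟩
  + (2 ^ n) *ᶻ ∏₃ (sideWeight σ₁ σ₂) A B T ∎
  where open ≡-Reasoning

χ-correlation : ∀ {n} (A B T : Subset n) →
  pow2 (A ─ T) *ᶻ pow2 (B ─ T) *ᶻ pow2 T *ᶻ ∑ (allSubsets n) (λ P → χ A T P *ᶻ χ B T P)
  ≡ + (2 ^ n) *ᶻ (+ 2 *ᶻ (pow2 ((A ∩ B) ─ T) -ᶻ ι (isEmpty ((A ∩ B) ─ T))))
χ-correlation {n} A B T = begin
  pow2 (A ─ T) *ᶻ pow2 (B ─ T) *ᶻ pow2 T *ᶻ ∑ Ps (λ P → χ A T P *ᶻ χ B T P)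
    ≡⟨ cong₂ _*ᶻ_ (sym (∏-scale A B T)) (trans (∑-cong Ps (χ*χ A B T)) (∑-alternating Ps _ _ _ _)) ⟩
  W *ᶻ (Σ true true -ᶻ Σ true false -ᶻ Σ false true +ᶻ Σ false false)
    ≡⟨ distrib W (Σ true true) (Σ true false) (Σ false true) (Σ false false) ⟩
  W *ᶻ Σ true true -ᶻ W *ᶻ Σ true false -ᶻ W *ᶻ Σ false true +ᶻ W *ᶻ Σ false false
    ≡⟨ cong₂ _+ᶻ_ (cong₂ _-ᶻ_ (cong₂ _-ᶻ_ (∑-both true true A B T) (∑-both true false A B T))
                              (∑-both false true A B T))
                  (∑-both false false A B T) ⟩
  N *ᶻ ∏₃ sameWeight A B T -ᶻ N *ᶻ ∏₃ oppositeWeight A B T -ᶻ N *ᶻ ∏₃ oppositeWeight A B T +ᶻ N *ᶻ ∏₃ sameWeight A B T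
    ≡⟨ cong₂ (λ x y → N *ᶻ x -ᶻ N *ᶻ y -ᶻ N *ᶻ y +ᶻ N *ᶻ x) (∏-same A B T) (∏-opposite A B T) ⟩
  N *ᶻ pow2 K -ᶻ N *ᶻ ι (isEmpty K) -ᶻ N *ᶻ ι (isEmpty K) +ᶻ N *ᶻ pow2 K
    ≡⟨ collect N (pow2 K) (ι (isEmpty K)) ⟩
  N *ᶻ (+ 2 *ᶻ (pow2 K -ᶻ ι (isEmpty K))) ∎
  where
  open ≡-Reasoning
  Ps = allSubsets n
  W = ∏₃ scale A B T
  N = + (2 ^ n)
  K = (A ∩ B) ─ T
  Σ : Bool → Bool → ℤ
  Σ σ₁ σ₂ = ∑ Ps (both σ₁ σ₂ A B T)
  ∑-alternating : (xs : List (Subset n)) (f g h k : Subset n → ℤ) →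
    ∑ xs (λ x → f x -ᶻ g x -ᶻ h x +ᶻ k x) ≡ ∑ xs f -ᶻ ∑ xs g -ᶻ ∑ xs h +ᶻ ∑ xs k
  ∑-alternating xs f g h k =
    trans (∑-+ xs (λ x → f x -ᶻ g x -ᶻ h x) k)
          (cong (_+ᶻ ∑ xs k) (trans (∑-- xs (λ x → f x -ᶻ g x) h) (cong (_-ᶻ ∑ xs h) (∑-- xs f g))))
  distrib : ∀ w a b c d → w *ᶻ (a -ᶻ b -ᶻ c +ᶻ d) ≡ w *ᶻ a -ᶻ w *ᶻ b -ᶻ w *ᶻ c +ᶻ w *ᶻ d
  distrib = solve-∀
  collect : ∀ m p z → m *ᶻ p -ᶻ m *ᶻ z -ᶻ m *ᶻ z +ᶻ m *ᶻ p ≡ m *ᶻ (+ 2 *ᶻ (p -ᶻ z))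
  collect = solve-∀

β : ∀ {n} {M : Set} → (Subset n → Subset n → Subset n → M → Bool) → M → Subset n → Subset n → ℤ
β bob msg T P = ι (isPartition T P) *ᶻ sgn (bob T P (∁ T ─ P) msg)

∑-isPartition : ∀ {n} (T : Subset n) → pow2 T *ᶻ ∑ (allSubsets n) (λ P → ι (isPartition T P)) ≡ + (2 ^ n)
∑-isPartition {n} T = begin
  pow2 T *ᶻ ∑ (allSubsets n) (λ P → ι (isPartition T P))
    ≡⟨ cong₂ _*ᶻ_ (pow2≡∏₃ T) (trans (∑-cong (allSubsets n) (isPartition≡∏₄ T)) (∑-∏₄ outsideT T T T)) ⟩
  ∏₃ (λ _ _ t → two^ t) T T T *ᶻ ∏₃ (λ a b t → outsideT a b t false +ᶻ outsideT a b t true) T T T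
    ≡⟨ ∏₃-* _ _ T T T ⟩
  ∏₃ (λ a b t → two^ t *ᶻ (outsideT a b t false +ᶻ outsideT a b t true)) T T T
    ≡⟨ ∏₃-cong coordinate T T T ⟩
  ∏₃ (λ _ _ _ → + 2 *ᶻ + 1) T T T
    ≡⟨ ∏₃-double (λ _ _ _ → + 1) T T T ⟩
  + (2 ^ n) *ᶻ ∏₃ (λ _ _ _ → + 1) T T T
    ≡⟨ trans (cong (+ (2 ^ n) *ᶻ_) (∏₃-one T)) (ℤP.*-identityʳ _) ⟩
  + (2 ^ n) ∎
  where
  open ≡-Reasoning
  outsideT : Bool → Bool → Bool → Bool → ℤ
  outsideT _ _ t p = ι (not p ∨ not t)
  isPartition≡∏₄ : ∀ {n} (T P : Subset n) → ι (isPartition T P) ≡ ∏₄ outsideT T T T P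
  isPartition≡∏₄ [] [] = refl
  isPartition≡∏₄ (t ∷ T) (p ∷ P) =
    trans (ι-isPartition-∷ t T p P) (cong (ι (not p ∨ not t) *ᶻ_) (isPartition≡∏₄ T P))
  pow2≡∏₃ : ∀ {n} (T : Subset n) → pow2 T ≡ ∏₃ (λ _ _ t → two^ t) T T T
  pow2≡∏₃ [] = refl
  pow2≡∏₃ (t ∷ T) = cong (two^ t *ᶻ_) (pow2≡∏₃ T)
  ∏₃-one : ∀ {n} (T : Subset n) → ∏₃ (λ _ _ _ → + 1) T T T ≡ + 1
  ∏₃-one [] = refl
  ∏₃-one (t ∷ T) = trans (ℤP.*-identityˡ _) (∏₃-one T)
  coordinate : ∀ a b t → two^ t *ᶻ (outsideT a b t false +ᶻ outsideT a b t true) ≡ + 2 *ᶻ + 1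
  coordinate a b true = refl
  coordinate a b false = refl

inPart-exclusive : ∀ {n} (S T P : Subset n) → ∣ S ─ T ∣ ≢ 0 →
                   inPart true S T P ≡ true → inPart false S T P ≡ true → ⊥
inPart-exclusive S T P S─T≢∅ in₁ in₂ = S─T≢∅ (⊆-both⇒empty (S ─ T) P (∁ T) in₁ in₂)

χ-square : ∀ {n} (S T : Subset n) → ∣ S ─ T ∣ ≢ 0 → ∀ P → χ S T P *ᶻ χ S T P ≡ ι (does (valid? S T P))
χ-square S T S─T≢∅ P =
  square (isPartition T P) (inPart true S T P) (inPart false S T P) (inPart-exclusive S T P S─T≢∅)
  where
  square : ∀ c u w → (u ≡ true → w ≡ true → ⊥) →
           (ι (c ∧ u) -ᶻ ι (c ∧ w)) *ᶻ (ι (c ∧ u) -ᶻ ι (c ∧ w)) ≡ ι (c ∧ (u ∨ w))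
  square true true true exclusive = ⊥-elim (exclusive refl refl)
  square true true false _ = refl
  square true false true _ = refl
  square true false false _ = refl
  square false u w _ = refl

β-square : ∀ {n} {M : Set} bob (msg : M) (T P : Subset n) →
           β bob msg T P *ᶻ β bob msg T P ≡ ι (isPartition T P)
β-square bob msg T P = square (isPartition T P) (bob T P (∁ T ─ P) msg)
  where
  square : ∀ c r → (ι c *ᶻ sgn r) *ᶻ (ι c *ᶻ sgn r) ≡ ι c
  square true true = refl
  square true false = refl
  square false r = refl

βχ : ∀ {n} {M : Set} bob (msg : M) (S T : Subset n) → ∣ S ─ T ∣ ≢ 0 → ∀ P →
     β bob msg T P *ᶻ χ S T P ≡ ι (does (valid? S T P)) -ᶻ + 2 *ᶻ ι (does (errs? bob msg S T P))
βχ bob msg S T S─T≢∅ P rewrite isYes≗does ((S ─ T) ⊆? P) =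
  agreement (isPartition T P) (inPart true S T P) (inPart false S T P) (bob T P (∁ T ─ P) msg)
            (inPart-exclusive S T P S─T≢∅)
  where
  agreement : ∀ c u w r → (u ≡ true → w ≡ true → ⊥) →
              (ι c *ᶻ sgn r) *ᶻ (ι (c ∧ u) -ᶻ ι (c ∧ w))
              ≡ ι (c ∧ (u ∨ w)) -ᶻ + 2 *ᶻ ι ((c ∧ (u ∨ w)) ∧ not (does (r ≟ᵇ u)))
  agreement true true true r exclusive = ⊥-elim (exclusive refl refl)
  agreement true true false true _ = refl
  agreement true true false false _ = refl
  agreement true false true true _ = refl
  agreement true false true false _ = refl
  agreement true false false true _ = refl
  agreement true false false false _ = refl
  agreement false u w r _ = refl

≤-by-square : ∀ {x y} c → y ≡ x +ᶻ c *ᶻ c → x ≤ᶻ y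
≤-by-square {x} c refl = ℤP.i≤i+j x (c *ᶻ c) {{nonNegative (square≥0 c)}}
  where
  square≥0 : ∀ c → +0 ≤ᶻ c *ᶻ c
  square≥0 (+ n) = subst (+0 ≤ᶻ_) (ℤP.pos-* n n) (+≤+ z≤n)
  square≥0 -[1+ n ] = +≤+ z≤n

+-cancelʳ-≤ : ∀ {a b c} → a +ᶻ c ≤ᶻ b +ᶻ c → a ≤ᶻ b
+-cancelʳ-≤ {a} {b} {c} le = subst₂ _≤ᶻ_ (cancel a c) (cancel b c) (ℤP.+-monoˡ-≤ (negᶻ c) le)
  where cancel : ∀ a c → a +ᶻ c +ᶻ negᶻ c ≡ a
        cancel = solve-∀

-- The averaging inequality, abstracted from the protocol.  χ S and β are
-- functions on a finite list Ps of points and τ, D, N are normalisations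
-- (2^|T|, 2^|S∖T|, 2ⁿ in the application); the hypotheses say that
-- Σ χ_A χ_B = N·W A B/(τD²), Σ β² = N/τ, Σ β χ_S = V S − 2 E S and
-- V S = 2N/(τD).
module Averaging {X Pt : Set} (𝒮 : List X) (Ps : List Pt)
  (χ : X → Pt → ℤ) (β : Pt → ℤ) (W : X → X → ℤ) (V E : X → ℤ) (τ D N : ℤ)
  .{{_ : NonNegative τ}} .{{_ : NonNegative D}} .{{_ : Positive N}}
  (correlation : ∀ {A B} → A ∈ 𝒮 → B ∈ 𝒮 → τ *ᶻ D *ᶻ D *ᶻ ∑ Ps (λ p → χ A p *ᶻ χ B p) ≡ N *ᶻ W A B)
  (energy : τ *ᶻ ∑ Ps (λ p → β p *ᶻ β p) ≡ N)
  (advantage : ∀ {S} → S ∈ 𝒮 → ∑ Ps (λ p → β p *ᶻ χ S p) ≡ V S -ᶻ + 2 *ᶻ E S)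
  (validity : ∀ {S} → S ∈ 𝒮 → τ *ᶻ D *ᶻ V S ≡ + 2 *ᶻ N)
  (few-errors : + 4 *ᶻ ∑ 𝒮 E ≤ᶻ ∑ 𝒮 V) where

  s : ℤ
  s = + length 𝒮

  F : Pt → ℤ
  F p = ∑ 𝒮 (λ S → χ S p)

  ΣW ΣV ΣE ΣF² Σβ² ΣβF : ℤ
  ΣW = ∑ 𝒮 (λ A → ∑ 𝒮 (W A))
  ΣV = ∑ 𝒮 V
  ΣE = ∑ 𝒮 E
  ΣF² = ∑ Ps (λ p → F p *ᶻ F p)
  Σβ² = ∑ Ps (λ p → β p *ᶻ β p)
  ΣβF = ∑ Ps (λ p → β p *ᶻ F p)

  open ℤP.≤-Reasoning

  ∑F² : τ *ᶻ D *ᶻ D *ᶻ ΣF² ≡ N *ᶻ ΣW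
  ∑F² = begin-equality
    τ *ᶻ D *ᶻ D *ᶻ ΣF²
      ≡⟨ cong (τ *ᶻ D *ᶻ D *ᶻ_) expand ⟩
    τ *ᶻ D *ᶻ D *ᶻ ∑ 𝒮 (λ A → ∑ 𝒮 (λ B → ∑ Ps (λ p → χ A p *ᶻ χ B p)))
      ≡⟨ sym (∑-* 𝒮 (τ *ᶻ D *ᶻ D) _) ⟩
    ∑ 𝒮 (λ A → τ *ᶻ D *ᶻ D *ᶻ ∑ 𝒮 (λ B → ∑ Ps (λ p → χ A p *ᶻ χ B p)))
      ≡⟨ ∑-congᵐ 𝒮 (λ A∈𝒮 → trans (sym (∑-* 𝒮 (τ *ᶻ D *ᶻ D) _)) (∑-congᵐ 𝒮 (correlation A∈𝒮))) ⟩
    ∑ 𝒮 (λ A → ∑ 𝒮 (λ B → N *ᶻ W A B))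
      ≡⟨ trans (∑-cong 𝒮 (λ A → ∑-* 𝒮 N (W A))) (∑-* 𝒮 N _) ⟩
    N *ᶻ ΣW ∎
    where
    expand : ΣF² ≡ ∑ 𝒮 (λ A → ∑ 𝒮 (λ B → ∑ Ps (λ p → χ A p *ᶻ χ B p)))
    expand = trans (∑-cong Ps (λ p → ∑-mul 𝒮 𝒮 (λ S → χ S p) (λ S → χ S p)))
             (trans (∑-swap Ps 𝒮 _) (∑-cong 𝒮 (λ A → ∑-swap Ps 𝒮 (λ p B → χ A p *ᶻ χ B p))))

  ∑βF : ΣβF ≡ ΣV -ᶻ + 2 *ᶻ ΣE
  ∑βF = trans (∑-cong Ps (λ p → sym (∑-* 𝒮 (β p) (λ S → χ S p))))
        (trans (∑-swap Ps 𝒮 _) (trans (∑-congᵐ 𝒮 advantage)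
        (trans (∑-- 𝒮 V (λ S → + 2 *ᶻ E S)) (cong (ΣV -ᶻ_) (∑-* 𝒮 (+ 2) E)))))

  ∑V : τ *ᶻ D *ᶻ ΣV ≡ s *ᶻ (+ 2 *ᶻ N)
  ∑V = trans (sym (∑-* 𝒮 (τ *ᶻ D) V)) (trans (∑-congᵐ 𝒮 validity) (∑-const 𝒮 (+ 2 *ᶻ N)))

  -- Cauchy–Schwarz without square roots: 2DsβF ≤ D²F² + s²β² at every point.
  am-gm : ∀ p → + 2 *ᶻ D *ᶻ s *ᶻ (β p *ᶻ F p) ≤ᶻ D *ᶻ D *ᶻ (F p *ᶻ F p) +ᶻ s *ᶻ s *ᶻ (β p *ᶻ β p)
  am-gm p = ≤-by-square (D *ᶻ F p -ᶻ s *ᶻ β p) (complete D s (β p) (F p))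
    where
    complete : ∀ d s b f → d *ᶻ d *ᶻ (f *ᶻ f) +ᶻ s *ᶻ s *ᶻ (b *ᶻ b)
                          ≡ + 2 *ᶻ d *ᶻ s *ᶻ (b *ᶻ f) +ᶻ (d *ᶻ f -ᶻ s *ᶻ b) *ᶻ (d *ᶻ f -ᶻ s *ᶻ b)
    complete = solve-∀

  upper : τ *ᶻ (+ 2 *ᶻ D *ᶻ s *ᶻ ΣβF) ≤ᶻ N *ᶻ ΣW +ᶻ N *ᶻ (s *ᶻ s)
  upper = begin
    τ *ᶻ (+ 2 *ᶻ D *ᶻ s *ᶻ ΣβF)
      ≡⟨ cong (τ *ᶻ_) (sym (∑-* Ps (+ 2 *ᶻ D *ᶻ s) (λ p → β p *ᶻ F p))) ⟩
    τ *ᶻ ∑ Ps (λ p → + 2 *ᶻ D *ᶻ s *ᶻ (β p *ᶻ F p))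
      ≤⟨ ℤP.*-monoˡ-≤-nonNeg τ (∑-mono Ps am-gm) ⟩
    τ *ᶻ ∑ Ps (λ p → D *ᶻ D *ᶻ (F p *ᶻ F p) +ᶻ s *ᶻ s *ᶻ (β p *ᶻ β p))
      ≡⟨ cong (τ *ᶻ_) (trans (∑-+ Ps _ _) (cong₂ _+ᶻ_ (∑-* Ps (D *ᶻ D) _) (∑-* Ps (s *ᶻ s) _))) ⟩
    τ *ᶻ (D *ᶻ D *ᶻ ΣF² +ᶻ s *ᶻ s *ᶻ Σβ²)
      ≡⟨ regroup τ D s ΣF² Σβ² ⟩
    τ *ᶻ D *ᶻ D *ᶻ ΣF² +ᶻ (s *ᶻ s) *ᶻ (τ *ᶻ Σβ²)
      ≡⟨ cong₂ _+ᶻ_ ∑F² (trans (cong ((s *ᶻ s) *ᶻ_) energy) (ℤP.*-comm (s *ᶻ s) N)) ⟩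
    N *ᶻ ΣW +ᶻ N *ᶻ (s *ᶻ s) ∎
    where
    regroup : ∀ t d s f b → t *ᶻ (d *ᶻ d *ᶻ f +ᶻ s *ᶻ s *ᶻ b) ≡ t *ᶻ d *ᶻ d *ᶻ f +ᶻ (s *ᶻ s) *ᶻ (t *ᶻ b)
    regroup = solve-∀

  -- Since 4ΣE ≤ ΣV, the advantage ΣV − 2ΣE is at least ΣV/2.
  lower : N *ᶻ (s *ᶻ s) +ᶻ N *ᶻ (s *ᶻ s) ≤ᶻ τ *ᶻ (+ 2 *ᶻ D *ᶻ s *ᶻ ΣβF)
  lower = begin
    N *ᶻ (s *ᶻ s) +ᶻ N *ᶻ (s *ᶻ s)
      ≡⟨ trans (regroup₁ N s) (cong (s *ᶻ_) (sym ∑V)) ⟩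
    s *ᶻ (τ *ᶻ D *ᶻ ΣV)
      ≡⟨ regroup₂ s τ D ΣV ⟩
    s *ᶻ (τ *ᶻ (D *ᶻ (ΣV +ᶻ +0)))
      ≤⟨ ℤP.*-monoˡ-≤-nonNeg s (ℤP.*-monoˡ-≤-nonNeg τ (ℤP.*-monoˡ-≤-nonNeg D
           (ℤP.+-monoʳ-≤ ΣV (ℤP.i≤j⇒0≤j-i few-errors)))) ⟩
    s *ᶻ (τ *ᶻ (D *ᶻ (ΣV +ᶻ (ΣV -ᶻ + 4 *ᶻ ΣE))))
      ≡⟨ regroup₃ s τ D ΣV ΣE ⟩
    τ *ᶻ (+ 2 *ᶻ D *ᶻ s *ᶻ (ΣV -ᶻ + 2 *ᶻ ΣE))
      ≡⟨ cong (λ z → τ *ᶻ (+ 2 *ᶻ D *ᶻ s *ᶻ z)) (sym ∑βF) ⟩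
    τ *ᶻ (+ 2 *ᶻ D *ᶻ s *ᶻ ΣβF) ∎
    where
    regroup₁ : ∀ n s → n *ᶻ (s *ᶻ s) +ᶻ n *ᶻ (s *ᶻ s) ≡ s *ᶻ (s *ᶻ (+ 2 *ᶻ n))
    regroup₁ = solve-∀
    regroup₂ : ∀ s t d v → s *ᶻ (t *ᶻ d *ᶻ v) ≡ s *ᶻ (t *ᶻ (d *ᶻ (v +ᶻ +0)))
    regroup₂ = solve-∀
    regroup₃ : ∀ s t d v e → s *ᶻ (t *ᶻ (d *ᶻ (v +ᶻ (v -ᶻ + 4 *ᶻ e)))) ≡ t *ᶻ (+ 2 *ᶻ d *ᶻ s *ᶻ (v -ᶻ + 2 *ᶻ e))
    regroup₃ = solve-∀

  pairs-bound : s *ᶻ s ≤ᶻ ΣW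
  pairs-bound = ℤP.*-cancelˡ-≤-pos (s *ᶻ s) ΣW N (+-cancelʳ-≤ (ℤP.≤-trans lower upper))

-- Per pair, 2(2^k − [k = 0]) ≤ 4(2^k − 1): for k ≥ 1 this says 2^k ≥ 2.
weight-bound : ∀ k → + 2 *ᶻ (+ (2 ^ k) -ᶻ ι (does (k ≟ℕ 0))) ≤ᶻ + 4 *ᶻ + (2 ^ k ∸ 1)
weight-bound zero = ℤP.≤-refl
weight-bound (suc j) = doubled (2 ^ j) (ℕP.m^n>0 2 j)
  where
  doubled : ∀ x → 0 < x → + 2 *ᶻ (+ (2 * x) -ᶻ +0) ≤ᶻ + 4 *ᶻ + (2 * x ∸ 1)
  doubled (suc c) _ = subst₂ _≤ᶻ_
    (trans (ℤP.pos-* 2 (2 * suc c)) (cong (+ 2 *ᶻ_) (sym (ℤP.+-identityʳ (+ (2 * suc c))))))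
    (ℤP.pos-* 4 (2 * suc c ∸ 1))
    (+≤+ (begin
      2 * (2 * suc c)      ≡⟨ expand₁ c ⟩
      4 + 4 * c            ≤⟨ ℕP.+-monoʳ-≤ 4 (ℕP.*-monoʳ-≤ 4 (ℕP.m≤m+n c c)) ⟩
      4 + 4 * (c + c)      ≡⟨ expand₂ c ⟩
      4 * (2 * suc c ∸ 1)  ∎))
    where
    open ℕP.≤-Reasoning
    expand₁ : ∀ c → 2 * (2 * (1 + c)) ≡ 4 + 4 * c
    expand₁ = solve-∀ℕ
    expand₂ : ∀ c → 4 + 4 * (c + c) ≡ 4 * (c + (1 + c + 0))
    expand₂ = solve-∀ℕ

excess : ℕ → ℕ
excess i = 2 ^ i ∸ 1

-- Choosing the level k: if s² ≤ 4 Σ_{1≤i≤n} (2^i − 1) pᵢ then some k ≥ 1 has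
-- s² ≤ 4·4^k·p_k, because Σ_{i≥1} (2^i − 1)/4^i < 1.
module ChooseLevel (s² : ℕ) (p : ℕ → ℕ) where

  Y : ℕ → ℕ
  Y j = sum (map (λ i → excess i * p i) (positives j))

  Good : ℕ → Set
  Good k = 1 ≤ k × s² ≤ 4 * 2 ^ (2 * k) * p k

  search : ∀ j → ∃ Good ⊎ (2 ^ (2 + j) * Y j + s² ≤ s² * 2 ^ j)
  search zero = inj₂ (ℕP.≤-reflexive (sym (ℕP.*-identityʳ s²)))
  search (suc j) with search j
  ... | inj₁ good = inj₁ good
  ... | inj₂ small with s² ≤? 4 * 2 ^ (2 * suc j) * p (suc j)
  ...   | yes good = inj₁ (suc j , s≤s z≤n , good)
  ...   | no bad = inj₂ (ℕP.+-cancelˡ-≤ s² _ _ (begin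
      s² + (2 * (2 * (2 * B)) * (excess (suc j) * p (suc j) + Y j) + s²)
        ≡⟨ regroup s² B (excess (suc j)) (p (suc j)) (Y j) ⟩
      2 * (2 * (2 * B)) * excess (suc j) * p (suc j) + 2 * (2 * (2 * B) * Y j + s²)
        ≤⟨ ℕP.+-mono-≤ (ℕP.*-monoˡ-≤ (p (suc j)) (ℕP.*-monoʳ-≤ (2 * (2 * (2 * B))) (ℕP.m∸n≤m (2 * B) 1)))
                       (ℕP.*-monoʳ-≤ 2 small) ⟩
      2 * (2 * (2 * B)) * (2 * B) * p (suc j) + 2 * (s² * B)
        ≡⟨ cong (_+ 2 * (s² * B)) (trans (square-level B (p (suc j))) (cong (λ z → 4 * z * p (suc j)) (sym (4^ j)))) ⟩
      4 * 2 ^ (2 * suc j) * p (suc j) + 2 * (s² * B)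
        ≤⟨ ℕP.+-monoˡ-≤ (2 * (s² * B)) (ℕP.<⇒≤ (ℕP.≰⇒> bad)) ⟩
      s² + 2 * (s² * B)
        ≡⟨ cong (λ z → s² + z) (swap s² B) ⟩
      s² + s² * (2 * B) ∎))
    where
    open ℕP.≤-Reasoning
    B = 2 ^ j
    regroup : ∀ s B c p y → s + (2 * (2 * (2 * B)) * (c * p + y) + s) ≡
                            2 * (2 * (2 * B)) * c * p + 2 * (2 * (2 * B) * y + s)
    regroup = solve-∀ℕ
    square-level : ∀ B p → 2 * (2 * (2 * B)) * (2 * B) * p ≡ 4 * (2 * B * (2 * B)) * p
    square-level = solve-∀ℕ
    swap : ∀ s B → 2 * (s * B) ≡ s * (2 * B)
    swap = solve-∀ℕ
    4^ : ∀ j → 2 ^ (2 * suc j) ≡ 2 ^ suc j * 2 ^ suc j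
    4^ j = trans (cong (λ e → 2 ^ (suc j + e)) (ℕP.+-identityʳ (suc j))) (ℕP.^-distribˡ-+-* 2 (suc j) (suc j))

  -- If s² ≤ 4 Y n then some level is good: otherwise s² 2ⁿ + s² ≤ s² 2ⁿ forces s² = 0.
  level : ∀ n → s² ≤ 4 * Y n → ∃ Good
  level n s²≤4Y with search n
  ... | inj₁ good = good
  ... | inj₂ small = 1 , s≤s z≤n , subst (_≤ 4 * 2 ^ (2 * 1) * p 1) (sym s²≡0) z≤n
    where
    open ℕP.≤-Reasoning
    absorbed : 2 ^ n * s² + s² ≤ 2 ^ n * s² + 0
    absorbed = begin
      2 ^ n * s² + s²       ≤⟨ ℕP.+-monoˡ-≤ s² (ℕP.*-monoʳ-≤ (2 ^ n) s²≤4Y) ⟩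
      2 ^ n * (4 * Y n) + s² ≡⟨ cong (_+ s²) (regroup (2 ^ n) (Y n)) ⟩
      2 ^ (2 + n) * Y n + s² ≤⟨ small ⟩
      s² * 2 ^ n             ≡⟨ trans (ℕP.*-comm s² (2 ^ n)) (sym (ℕP.+-identityʳ _)) ⟩
      2 ^ n * s² + 0         ∎
      where regroup : ∀ b y → b * (4 * y) ≡ 2 * (2 * b) * y
            regroup = solve-∀ℕ
    s²≡0 : s² ≡ 0
    s²≡0 = ℕP.n≤0⇒n≡0 (ℕP.+-cancelˡ-≤ (2 ^ n * s²) _ _ absorbed)

module OneMessageClass {n : ℕ} {M : Set} (m : ℕ) (alice : Subset n → M)
  (bob : Subset n → Subset n → Subset n → M → Bool)
  (𝒮 : List (Subset n)) (T : Subset n) (msg : M)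
  (T⊂S : ∀ {S} → S ∈ 𝒮 → T ⊂ S) (∣S∣≡m : ∀ {S} → S ∈ 𝒮 → ∣ S ∣ ≡ m)
  (message : ∀ {S} → S ∈ 𝒮 → alice S ≡ msg)
  (few-errors : 4 * sum (map (λ S → errCount alice bob S T) 𝒮) ≤ sum (map (λ S → validCount S T) 𝒮)) where

  Ps : List (Subset n)
  Ps = allSubsets n

  -- Every S∖T has the same size d, so χ_S has the same normalisation D = 2^d.
  d : ℕ
  d = m ∸ ∣ T ∣

  τ D N : ℤ
  τ = + (2 ^ ∣ T ∣)
  D = + (2 ^ d)
  N = + (2 ^ n)

  ∣S─T∣≡d : ∀ {S} → S ∈ 𝒮 → ∣ S ─ T ∣ ≡ d
  ∣S─T∣≡d {S} S∈𝒮 = trans (sym (ℕP.m+n∸n≡m ∣ S ─ T ∣ ∣ T ∣))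
    (cong (_∸ ∣ T ∣) (trans (∣─∣+∣∣ S T (proj₁ (T⊂S S∈𝒮))) (∣S∣≡m S∈𝒮)))

  pow2-S─T : ∀ {S} → S ∈ 𝒮 → pow2 (S ─ T) ≡ D
  pow2-S─T {S} S∈𝒮 = trans (pow2≡ (S ─ T)) (cong (λ k → + (2 ^ k)) (∣S─T∣≡d S∈𝒮))

  S─T≢∅ : ∀ {S} → S ∈ 𝒮 → ∣ S ─ T ∣ ≢ 0
  S─T≢∅ {S} S∈𝒮 = ⊂⇒∣─∣≢0 S T (T⊂S S∈𝒮)

  W : Subset n → Subset n → ℤ
  W A B = + 2 *ᶻ (pow2 ((A ∩ B) ─ T) -ᶻ ι (isEmpty ((A ∩ B) ─ T)))

  V E : Subset n → ℤ
  V S = + validCount S T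
  E S = + errCount alice bob S T

  correlation : ∀ {A B} → A ∈ 𝒮 → B ∈ 𝒮 → τ *ᶻ D *ᶻ D *ᶻ ∑ Ps (λ P → χ A T P *ᶻ χ B T P) ≡ N *ᶻ W A B
  correlation {A} {B} A∈𝒮 B∈𝒮 = begin
    τ *ᶻ D *ᶻ D *ᶻ Σχχ               ≡⟨ reorder τ D Σχχ ⟩
    D *ᶻ D *ᶻ τ *ᶻ Σχχ               ≡⟨ cong (λ z → z *ᶻ Σχχ) (sym (cong₂ _*ᶻ_ (cong₂ _*ᶻ_ (pow2-S─T A∈𝒮) (pow2-S─T B∈𝒮)) (pow2≡ T))) ⟩
    pow2 (A ─ T) *ᶻ pow2 (B ─ T) *ᶻ pow2 T *ᶻ Σχχ ≡⟨ χ-correlation A B T ⟩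
    N *ᶻ W A B ∎
    where
    open ≡-Reasoning
    Σχχ = ∑ Ps (λ P → χ A T P *ᶻ χ B T P)
    reorder : ∀ t d x → t *ᶻ d *ᶻ d *ᶻ x ≡ d *ᶻ d *ᶻ t *ᶻ x
    reorder = solve-∀

  energy : τ *ᶻ ∑ Ps (λ P → β bob msg T P *ᶻ β bob msg T P) ≡ N
  energy = trans (cong₂ _*ᶻ_ (sym (pow2≡ T)) (∑-cong Ps (β-square bob msg T))) (∑-isPartition T)

  advantage : ∀ {S} → S ∈ 𝒮 → ∑ Ps (λ P → β bob msg T P *ᶻ χ S T P) ≡ V S -ᶻ + 2 *ᶻ E S
  advantage {S} S∈𝒮 = begin
    ∑ Ps (λ P → β bob msg T P *ᶻ χ S T P)
      ≡⟨ ∑-cong Ps (βχ bob msg S T (S─T≢∅ S∈𝒮)) ⟩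
    ∑ Ps (λ P → ι (does (valid? S T P)) -ᶻ + 2 *ᶻ ι (does (errs? bob msg S T P)))
      ≡⟨ trans (∑-- Ps valid (λ P → + 2 *ᶻ err P)) (cong (∑ Ps valid -ᶻ_) (∑-* Ps (+ 2) err)) ⟩
    ∑ Ps (λ P → ι (does (valid? S T P))) -ᶻ + 2 *ᶻ ∑ Ps (λ P → ι (does (errs? bob msg S T P)))
      ≡⟨ cong₂ (λ v e → v -ᶻ + 2 *ᶻ e) (∑-count (valid? S T) Ps) (∑-count (errs? bob msg S T) Ps) ⟩
    + validCount S T -ᶻ + 2 *ᶻ + length (filter (errs? bob msg S T) Ps)
      ≡⟨ cong (λ a → + validCount S T -ᶻ + 2 *ᶻ + length (filter (errs? bob a S T) Ps)) (sym (message S∈𝒮)) ⟩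
    V S -ᶻ + 2 *ᶻ E S ∎
    where
    open ≡-Reasoning
    valid err : Subset n → ℤ
    valid P = ι (does (valid? S T P))
    err P = ι (does (errs? bob msg S T P))

  -- The correlation of S with itself counts its valid inputs: τ D V_S = 2N.
  validity : ∀ {S} → S ∈ 𝒮 → τ *ᶻ D *ᶻ V S ≡ + 2 *ᶻ N
  validity {S} S∈𝒮 = ℤP.*-cancelˡ-≡ D (τ *ᶻ D *ᶻ V S) (+ 2 *ᶻ N) {{ℕP.m^n≢0 2 d}} (begin
    D *ᶻ (τ *ᶻ D *ᶻ V S)                       ≡⟨ reorder D τ (V S) ⟩
    τ *ᶻ D *ᶻ D *ᶻ V S                         ≡⟨ cong (τ *ᶻ D *ᶻ D *ᶻ_) (sym Σχ²≡V) ⟩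
    τ *ᶻ D *ᶻ D *ᶻ ∑ Ps (λ P → χ S T P *ᶻ χ S T P) ≡⟨ correlation S∈𝒮 S∈𝒮 ⟩
    N *ᶻ W S S                                 ≡⟨ cong (λ K → N *ᶻ (+ 2 *ᶻ (pow2 K -ᶻ ι (isEmpty K)))) (cong (_─ T) (∩-idem S)) ⟩
    N *ᶻ (+ 2 *ᶻ (pow2 (S ─ T) -ᶻ ι (isEmpty (S ─ T))))
      ≡⟨ cong₂ (λ p e → N *ᶻ (+ 2 *ᶻ (p -ᶻ ι e))) (pow2-S─T S∈𝒮)
               (trans (isEmpty≡ (S ─ T)) (dec-false (∣ S ─ T ∣ ≟ℕ 0) (S─T≢∅ S∈𝒮))) ⟩
    N *ᶻ (+ 2 *ᶻ (D -ᶻ +0))                    ≡⟨ collect D N ⟩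
    D *ᶻ (+ 2 *ᶻ N) ∎)
    where
    open ≡-Reasoning
    Σχ²≡V : ∑ Ps (λ P → χ S T P *ᶻ χ S T P) ≡ V S
    Σχ²≡V = trans (∑-cong Ps (χ-square S T (S─T≢∅ S∈𝒮))) (∑-count (valid? S T) Ps)
    reorder : ∀ d t v → d *ᶻ (t *ᶻ d *ᶻ v) ≡ t *ᶻ d *ᶻ d *ᶻ v
    reorder = solve-∀
    collect : ∀ d n → n *ᶻ (+ 2 *ᶻ (d -ᶻ +0)) ≡ d *ᶻ (+ 2 *ᶻ n)
    collect = solve-∀

  few-errorsᶻ : + 4 *ᶻ ∑ 𝒮 E ≤ᶻ ∑ 𝒮 V
  few-errorsᶻ = subst₂ _≤ᶻ_
    (trans (ℤP.pos-* 4 (sum (map (λ S → errCount alice bob S T) 𝒮))) (cong (+ 4 *ᶻ_) (sym (∑-sum 𝒮 (λ S → errCount alice bob S T)))))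
    (sym (∑-sum 𝒮 (λ S → validCount S T)))
    (+≤+ few-errors)

  open Averaging 𝒮 Ps (λ S → χ S T) (β bob msg T) W V E τ D N {{_}} {{_}} {{positive (+<+ (ℕP.m^n>0 2 n))}}
                 correlation energy advantage validity few-errorsᶻ using (pairs-bound)

  s : ℕ
  s = length 𝒮

  excessOf : Subset n → Subset n → ℕ
  excessOf A B = excess ∣ (A ∩ B) ─ T ∣

  excess-bound : 4 * sumPairs 𝒮 excessOf ≥ s * s
  excess-bound = ℤP.drop‿+≤+ (subst₂ _≤ᶻ_ (sym (ℤP.pos-* s s)) (sym (ℤP.pos-* 4 (sumPairs 𝒮 excessOf)))
    (ℤP.≤-trans pairs-bound (ℤP.≤-trans
      (∑-mono 𝒮 (λ A → ∑-mono 𝒮 (λ B → W≤4·excess A B)))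
      (ℤP.≤-reflexive (trans (∑-cong 𝒮 (λ A → ∑-* 𝒮 (+ 4) (λ B → + excessOf A B)))
        (trans (∑-* 𝒮 (+ 4) _) (cong (+ 4 *ᶻ_) (sym (∑-pairs 𝒮 𝒮 excessOf)))))))))
    where
    W≤4·excess : ∀ A B → W A B ≤ᶻ + 4 *ᶻ + excessOf A B
    W≤4·excess A B = subst (_≤ᶻ + 4 *ᶻ + excessOf A B)
      (cong₂ (λ p e → + 2 *ᶻ (p -ᶻ ι e)) (sym (pow2≡ ((A ∩ B) ─ T))) (sym (isEmpty≡ ((A ∩ B) ─ T))))
      (weight-bound ∣ (A ∩ B) ─ T ∣)

  open ChooseLevel (s * s) (pairsWith 𝒮 T) using (Y; level)

  by-level : sumPairs 𝒮 excessOf ≡ Y n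
  by-level = ℤP.+-injective (begin
    + sumPairs 𝒮 excessOf
      ≡⟨ ∑-pairs 𝒮 𝒮 excessOf ⟩
    ∑ 𝒮 (λ A → ∑ 𝒮 (λ B → + excessOf A B))
      ≡⟨ ∑-cong 𝒮 (λ A → ∑-cong 𝒮 (λ B → sym (∑-indicator n (size A B) (∣p∣≤n ((A ∩ B) ─ T)) c refl))) ⟩
    ∑ 𝒮 (λ A → ∑ 𝒮 (λ B → ∑ (positives n) (λ i → c i *ᶻ at i A B)))
      ≡⟨ trans (∑-cong 𝒮 (λ A → ∑-swap 𝒮 (positives n) _)) (∑-swap 𝒮 (positives n) _) ⟩
    ∑ (positives n) (λ i → ∑ 𝒮 (λ A → ∑ 𝒮 (λ B → c i *ᶻ at i A B)))
      ≡⟨ ∑-cong (positives n) (λ i → trans (∑-cong 𝒮 (λ A → ∑-* 𝒮 (c i) _)) (∑-* 𝒮 (c i) _)) ⟩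
    ∑ (positives n) (λ i → c i *ᶻ ∑ 𝒮 (λ A → ∑ 𝒮 (at i A)))
      ≡⟨ ∑-cong (positives n) (λ i → trans (cong (c i *ᶻ_) (sym (count i))) (sym (ℤP.pos-* (excess i) _))) ⟩
    ∑ (positives n) (λ i → + (excess i * pairsWith 𝒮 T i))
      ≡⟨ ∑-sum (positives n) _ ⟩
    + Y n ∎)
    where
    open ≡-Reasoning
    c : ℕ → ℤ
    c i = + excess i
    size : Subset n → Subset n → ℕ
    size A B = ∣ (A ∩ B) ─ T ∣
    at : ℕ → Subset n → Subset n → ℤ
    at i A B = ι (does (size A B ≟ℕ i))
    count : ∀ i → + pairsWith 𝒮 T i ≡ ∑ 𝒮 (λ A → ∑ 𝒮 (at i A))
    count i = trans (∑-pairs 𝒮 𝒮 _) (∑-cong 𝒮 (λ A → ∑-cong 𝒮 (λ B → indicator (size A B ≟ℕ i))))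
      where indicator : ∀ {P : Set} (P? : Dec P) → + (if ⌊ P? ⌋ then 1 else 0) ≡ ι (does P?)
            indicator (yes _) = refl
            indicator (no _) = refl

  level-bound : ∃[ k ] (k ≥ 1 × 4 * 2 ^ (2 * k) * pairsWith 𝒮 T k ≥ s * s)
  level-bound = level n (subst (λ z → s * s ≤ 4 * z) by-level excess-bound)

lemma4 : (m : ℕ) (M : Set)
    (alice : Subset (Univ m) → M)
    (bob : Subset (Univ m) → Subset (Univ m) → Subset (Univ m) → M → Bool)
    (𝒮 : List (Subset (Univ m))) (T : Subset (Univ m)) →
    𝒮 ≢ [] → Unique 𝒮 →
    All (OnePerBlock m) 𝒮 →
    (∀ {S₁ S₂} → S₁ ∈ 𝒮 → S₂ ∈ 𝒮 → alice S₁ ≡ alice S₂) →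
    All (λ S → T ⊂ S) 𝒮 →
    4 * sum (map (λ S → errCount alice bob S T) 𝒮) ≤ sum (map (λ S → validCount S T) 𝒮) →
    (4 * sumPairs 𝒮 (λ S₁ S₂ → 2 ^ ∣ (S₁ ∩ S₂) ─ T ∣ ∸ 1) ≥ length 𝒮 * length 𝒮)
    × (∃[ k ] (k ≥ 1 × 4 * 2 ^ (2 * k) * pairsWith 𝒮 T k ≥ length 𝒮 * length 𝒮))
lemma4 m M alice bob [] T 𝒮≢[] _ _ _ _ _ = ⊥-elim (𝒮≢[] refl)
lemma4 m M alice bob 𝒮@(S₀ ∷ _) T _ _ one-per-block same-message T⊂S few-errors = excess-bound , level-bound
  where
  open OneMessageClass m alice bob 𝒮 T (alice S₀) (All-lookup T⊂S) (λ S∈𝒮 → proj₁ (All-lookup one-per-block S∈𝒮))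
    (λ S∈𝒮 → same-message S∈𝒮 (here refl)) few-errors
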